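{- Let $\mathbf{O}$ be an appropriate class of operators and $k\in\mathbb{N}$. Then: (1) the $k$-ary operator $F$ with $F(f_1,\ldots,f_k)=\mathrm{id}_\mathbb{N}$ belongs to $\mathbf{O}$; (2) for any $i\in\{1,\ldots,k\}$, if $F_0$ is a $k$-ary operator in $\mathbf{O}$, then so is the operator $F$ defined by $F(f_1,\ldots,f_k)(n)=f_i(F_0(f_1,\ldots,f_k)(n))$; (3) for any $r\in\mathbb{N}$ and any $r$-argument $\mathbf{O}$-representable function $f$, if $F_1,\ldots,F_r$ are $k$-ary operators in $\mathbf{O}$, then so is the operator $F$ defined by $F(f_1,\ldots,f_k)(n)=f(F_1(f_1,\ldots,f_k)(n),\ldots,F_r(f_1,\ldots,f_k)(n))$.
   Context: $\mathbb{T}_1$ is the set of total functions $\mathbb{N}\to\mathbb{N}$; a $k$-ary operator is a map $\mathbb{T}_1^k\to\mathbb{T}_1$; $\check{c}\in\mathbb{T}_1$ is the constant function with value $c$; $\mathrm{id}_\mathbb{N}$ is the identity function on $\mathbb{N}$. A class $\mathbf{O}$ of operators is appropriate if: (1) for all $k$ and $i\le k$ the operator $(f_1,\ldots,f_k)\mapsto f_i$ is in $\mathbf{O}$; (2) the operator $F(f_1,f_2)(n)=f_1(f_2(n))$ is in $\mathbf{O}$; (3) if $F$ is $k$-ary in $\mathbf{O}$ and $G_1,\ldots,G_k$ are $l$-ary in $\mathbf{O}$, then $H(g_1,\ldots,g_l)=F(G_1(g_1,\ldots,g_l),\ldots,G_k(g_1,\ldots,g_l))$ is in $\mathbf{O}$;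 (4) if $F$ is $(k+1)$-ary in $\mathbf{O}$, then $G(f_1,\ldots,f_k)(n)=F(f_1,\ldots,f_k,\check{n})(n)$ is in $\mathbf{O}$. For $f:\mathbb{N}^r\to\mathbb{N}$, $\mathring{f}$ is the $r$-ary operator $\mathring{f}(f_1,\ldots,f_r)(n)=f(f_1(n),\ldots,f_r(n))$; $f$ is $\mathbf{O}$-representable if $\mathring{f}\in\mathbf{O}$. -}

module Defs where

open import Data.Nat using (ℕ; suc)
open import Data.Fin using (Fin; fromℕ; inject₁)
open import Data.Fin.Base using (zero; suc)
open import Data.Product using (_×_)

T₁ : Set
T₁ = ℕ → ℕ

-- k-ary operator: map 𝕋₁^k → 𝕋₁ (tuples as functions Fin k → 𝕋₁;
-- index i : Fin k corresponds to the paper's index i+1)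
Op : ℕ → Set
Op k = (Fin k → T₁) → T₁

consť : ℕ → T₁
consť c = λ _ → c

snoc : ∀ {A : Set} {k} → (Fin k → A) → A → Fin (suc k) → A
snoc {k = Data.Nat.zero} fs g zero = g
snoc {k = suc k} fs g zero = fs zero
snoc {k = suc k} fs g (suc i) = snoc (λ j → fs (suc j)) g i

Class : Set₁
Class = (k : ℕ) → Op k → Set

record Appropriate (O : Class) : Set where
  field
    proj : ∀ k (i : Fin k) → O k (λ fs → fs i)
    comp : O 2 (λ fs n → fs zero (fs (suc zero) n))
    subst : ∀ k l (F : Op k) (Gs : Fin k → Op l) →
            O k F → (∀ j → O l (Gs j)) →
            O l (λ gs → F (λ j → Gs j gs))
    diag : ∀ k (F : Op (suc k)) → O (suc k) F →
           O k (λ fs n → F (snoc fs (consť n)) n)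

-- f̊ for f : ℕ^r → ℕ (arguments as Fin r → ℕ)
ring : ∀ {r} → ((Fin r → ℕ) → ℕ) → Op r
ring f fs n = f (λ j → fs j n)

Representable : Class → ∀ {r} → ((Fin r → ℕ) → ℕ) → Set
Representable O {r} f = O r (ring f)

-- All three parts are instances of the substitution rule (3):
--   * The nullary operator returning id_ℕ arises from the unary projection
--     f ↦ f by the diagonal rule (4), which substitutes the constant č_n and
--     evaluates at n, giving n ↦ č_n(n) = n.  Substituting it into the empty
--     family of k-ary operators lifts it to any arity k.
--   * Post-composition with an argument f_i is the composition operator (2)
--     with the projection onto f_i and F₀ substituted for its two arguments.
--   * For a representable f, the operator f̊ lies in O, and substituting
--     F₁,…,F_r into f̊ is exactly the pointwise application of f.
module Submission where

open import Defs
open import Data.Nat using (ℕ)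
open import Data.Fin using (Fin)
open import Data.Fin.Base using (zero; suc)
open import Data.Product using (_×_; _,_)

module AppropriateClosure (O : Class) (appropriate : Appropriate O) where
  open Appropriate appropriate

  -- The nullary operator whose value is the identity function:
  -- diagonalising the projection f ↦ f yields n ↦ č_n(n) = n.
  identity-nullary : O 0 (λ fs n → n)
  identity-nullary = diag 0 (λ fs → fs zero) (proj 1 zero)

  weaken-nullary : ∀ k (F : Op 0) → O 0 F → O k (λ fs → F (λ ()))
  weaken-nullary k F F∈O = subst 0 k F (λ ()) F∈O (λ ())

  identity-operator : ∀ k → O k (λ fs n → n)
  identity-operator k = weaken-nullary k (λ fs n → n) identity-nullary

  compose-argument : ∀ k (i : Fin k) (F₀ : Op k) → O k F₀ →
                     O k (λ fs n → fs i (F₀ fs n))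
  compose-argument k i F₀ F₀∈O = subst 2 k _ components comp components∈O
    where
    components : Fin 2 → Op k
    components zero       = λ fs → fs i
    components (suc zero) = F₀

    components∈O : ∀ j → O k (components j)
    components∈O zero       = proj k i
    components∈O (suc zero) = F₀∈O

  apply-representable : ∀ k r (f : (Fin r → ℕ) → ℕ) → Representable O f →
                        (Fs : Fin r → Op k) → (∀ j → O k (Fs j)) →
                        O k (λ fs n → f (λ j → Fs j fs n))
  apply-representable k r f f̊∈O Fs Fs∈O = subst r k (ring f) Fs f̊∈O Fs∈O

lemma6 : (O : Class) → Appropriate O → (k : ℕ) →
    O k (λ fs n → n)
    × (∀ (i : Fin k) (F₀ : Op k) → O k F₀ →
    O k (λ fs n → fs i (F₀ fs n)))
    × (∀ (r : ℕ) (f : (Fin r → ℕ) → ℕ) → Representable O f →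
    (Fs : Fin r → Op k) → (∀ j → O k (Fs j)) →
    O k (λ fs n → f (λ j → Fs j fs n)))
lemma6 O appropriate k =
    identity-operator k
  , compose-argument k
  , apply-representable k
  where open AppropriateClosure O appropriate
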